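{- Fix an integer $b>4$. For integers $k$ and $h\ge0$, let $\bar D(h,k)$ be given by $\bar D(0,k)=k$ and $\bar D(h,k)=\frac{D(h,k)}{D(h-1,k)+1}$ for $h>0$, where $D(0,k)=k$, $D(h,k)=k+b\,(d(h-1,k)-1)$ for $h>0$, and $d(0,k)=k$, $d(1,k)=kb-b$, $d(\delta,k)=b\,(d(\delta-1,k)-d(\delta-2,k))$ for $\delta\ge2$. Then $\bar D(h,k)$ is an increasing function of $h$ for $2\le k\le b-2$, and a decreasing function of $h$ for $k\ge b-1$.
   Context: $\bar D(h,k)$ equals the average node degree (sum of node degrees divided by number of nodes) of every $(b,k)$-overslack tree of height $h$: a leaf-oriented search tree whose root has degree $k$, with all leaves at depth $h$, internal nodes having $2$ to $b$ child pointers, leaves having $0$ to $b$ keys, and, for every internal node $u$, the children of $u$ containing a total of exactly $b$ slack (the degree of an internal node is its number of child pointers, of a leaf its number of keys; slack is $b$ minus degree). -}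

module Defs where

open import Data.Nat using (ℕ; zero; suc)
open import Data.Integer using (ℤ; +_; -[1+_]; _+_; _*_; _-_; -_)
open import Data.Rational using (ℚ; _/_; 0ℚ)

d : ℕ → ℕ → ℤ → ℤ
d b zero k = k
d b (suc zero) k = k * + b - + b
d b (suc (suc δ)) k = + b * (d b (suc δ) k - d b δ k)

D : ℕ → ℕ → ℤ → ℤ
D b zero k = k
D b (suc h) k = k + + b * (d b h k - + 1)

-- exact rational division of integers; division by zero returns 0
-- (never used in the range of the theorem, where denominators are positive)
_÷ℤ_ : ℤ → ℤ → ℚ
n ÷ℤ (+ zero) = 0ℚ
n ÷ℤ (+ (suc m)) = n / suc m
n ÷ℤ (-[1+ m ]) = (- n) / suc m

Dbar : ℕ → ℕ → ℤ → ℚ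
Dbar b zero k = k ÷ℤ (+ 1)
Dbar b (suc h) k = D b (suc h) k ÷ℤ (D b h k + + 1)

-- Write D̄(h) = D(h) / δ(h) with δ(0) = 1 and δ(h+1) = D(h) + 1. The denominators are positive,
-- so D̄(h) < D̄(h+1) exactly when the cross difference C(h) = D(h+1) δ(h) − D(h) δ(h+1) is positive.
-- The shifted sequence D(h) − (k − b) = b d(h−1, k) satisfies x(h+2) = b (x(h+1) − x(h)), whose
-- characteristic polynomial is χ(x) = x² − b x + b and whose Casoratian is χ(k) b^(h+2). Hence C
-- satisfies the same recurrence forced by −χ(k) b^(h+2), so C(h) = −χ(k) w(h) with w depending on b
-- alone. Like every sequence with w(h+2) ≥ b (w(h+1) − w(h)), b ≥ 4 and w(1) ≥ 2 w(0) > 0, w keeps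
-- doubling, so it is positive. Finally −χ(k) = (k−2)(b−2−k) + b − 4 > 0 for 2 ≤ k ≤ b − 2, and
-- χ(k) = 1 + (k−1)(k+1−b) > 0 for k ≥ b − 1.

module Submission where

open import Defs
open import Data.Nat using (ℕ; _∸_)
open import Data.Integer using (ℤ; +_)
open import Data.Product using (_×_)
import Data.Nat as N
import Data.Integer as Z
import Data.Rational as Q

open import Data.Nat using (zero; suc; z≤n; s≤s; _<′_; ≤′-refl; ≤′-step)
import Data.Nat.Properties as NP
open import Data.Integer using (0ℤ; 1ℤ; _+_; _-_; _*_; -_; _^_; _≤_; _<_; +≤+; +<+)
open import Data.Integer.Base using (nonNegative; positive)
import Data.Integer.Properties as ZP
open import Data.Integer.Tactic.RingSolver using (solve-∀)
import Data.Rational.Unnormalised as ℚᵘ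
import Data.Rational.Unnormalised.Properties as ℚᵘP
import Data.Rational.Properties as QP
open import Data.Product using (_,_; proj₁; proj₂)
open import Function using (flip)
open import Relation.Binary.Core using (Rel)
open import Relation.Binary.Definitions using (Transitive)
open import Relation.Binary.PropositionalEquality
open import Algebra.Properties.CommutativeSemigroup ZP.*-commutativeSemigroup using (x∙yz≈y∙xz)
open import Algebra.Properties.AbelianGroup ZP.+-0-abelianGroup using (//-rightDividesˡ; ⁻¹-anti-homo‿-)

step⇒ascending : ∀ {a ℓ} {A : Set a} {_≺_ : Rel A ℓ} → Transitive _≺_ →
  (f : ℕ → A) → (∀ n → f n ≺ f (suc n)) → ∀ {m n} → m N.< n → f m ≺ f n
step⇒ascending {_≺_ = _≺_} ≺-trans f step {m} m<n = go (NP.<⇒<′ m<n)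
  where
  go : ∀ {n} → m <′ n → f m ≺ f n
  go ≤′-refl = step m
  go (≤′-step m<′n) = ≺-trans (go m<′n) (step _)

recurrence-unique : ∀ {a} {A : Set a} (step : ℕ → A → A → A) (x y : ℕ → A) →
  (∀ n → x (suc (suc n)) ≡ step n (x (suc n)) (x n)) →
  (∀ n → y (suc (suc n)) ≡ step n (y (suc n)) (y n)) →
  x 0 ≡ y 0 → x 1 ≡ y 1 → ∀ n → x n ≡ y n
recurrence-unique step x y x-rec y-rec x₀≡y₀ x₁≡y₁ n = proj₁ (consecutive n)
  where
  consecutive : ∀ n → x n ≡ y n × x (suc n) ≡ y (suc n)
  consecutive zero = x₀≡y₀ , x₁≡y₁
  consecutive (suc n) with consecutive n
  ... | xₙ≡yₙ , xₙ₊₁≡yₙ₊₁ =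
    xₙ₊₁≡yₙ₊₁ , trans (x-rec n) (trans (cong₂ (step n) xₙ₊₁≡yₙ₊₁ xₙ≡yₙ) (sym (y-rec n)))

*-nonNeg : ∀ {i j} → 0ℤ ≤ i → 0ℤ ≤ j → 0ℤ ≤ i * j
*-nonNeg {j = j} 0≤i 0≤j = ZP.*-monoʳ-≤-nonNeg j {{nonNegative 0≤j}} 0≤i

*-pos : ∀ {i j} → 0ℤ < i → 0ℤ < j → 0ℤ < i * j
*-pos {j = j} 0<i 0<j = ZP.*-monoʳ-<-pos j {{positive 0<j}} 0<i

^-nonNeg : ∀ {i} n → 0ℤ ≤ i → 0ℤ ≤ i ^ n
^-nonNeg zero _ = +≤+ z≤n
^-nonNeg (suc n) 0≤i = *-nonNeg 0≤i (^-nonNeg n 0≤i)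

0<1+i : ∀ {i} → 0ℤ ≤ i → 0ℤ < 1ℤ + i
0<1+i 0≤i = ZP.suc[i]≤j⇒i<j (ZP.suc-mono 0≤i)

0<j-i⇒i<j : ∀ {i j} → 0ℤ < j - i → i < j
0<j-i⇒i<j {i} {j} 0<j-i = subst₂ _<_ (ZP.+-identityˡ i) (//-rightDividesˡ i j) (ZP.+-monoˡ-< i 0<j-i)

÷ℤ-< : ∀ {i j m n} → 0ℤ < m → 0ℤ < n → 0ℤ < j * m - i * n → i ÷ℤ m Q.< j ÷ℤ n
÷ℤ-< {i} {j} {+ suc m} {+ suc n} _ _ 0<cross =
  QP.toℚᵘ-cancel-<
    (ℚᵘP.<-respʳ-≃ (ℚᵘP.≃-sym (QP.toℚᵘ-fromℚᵘ v))
      (ℚᵘP.<-respˡ-≃ (ℚᵘP.≃-sym (QP.toℚᵘ-fromℚᵘ u)) (ℚᵘ.*<* (0<j-i⇒i<j 0<cross))))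
  where
  u v : ℚᵘ.ℚᵘ
  u = ℚᵘ.mkℚᵘ i m
  v = ℚᵘ.mkℚᵘ j n
÷ℤ-< {m = + zero} (+<+ ()) _ _
÷ℤ-< {m = + suc _} {+ zero} _ (+<+ ()) _

module Doubling {b : ℕ} (4≤b : 4 N.≤ b) (x : ℕ → ℤ)
  (recurrence : ∀ n → + b * (x (suc n) - x n) ≤ x (suc (suc n)))
  (0<x₀ : 0ℤ < x 0) (2x₀≤x₁ : + 2 * x 0 ≤ x 1) where

  private
    doubled⇒≤ : ∀ {i j} → 0ℤ < i → + 2 * i ≤ j → i ≤ j
    doubled⇒≤ {i} 0<i 2i≤j = ZP.≤-trans i≤2i 2i≤j
      where
      i≤2i : i ≤ + 2 * i
      i≤2i = subst (_≤ + 2 * i) (ZP.*-identityˡ i)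
        (ZP.*-monoʳ-≤-nonNeg i {{nonNegative (ZP.<⇒≤ 0<i)}} (+≤+ (s≤s (z≤n {1}))))

    double-difference : ∀ x x′ → + 2 * x′ + + 2 * (x′ - + 2 * x) ≡ + 4 * (x′ - x)
    double-difference = solve-∀

  doubling : ∀ n → 0ℤ < x n × + 2 * x n ≤ x (suc n)
  doubling zero = 0<x₀ , 2x₀≤x₁
  doubling (suc n) with doubling n
  ... | 0<x , 2x≤x′ = ZP.<-≤-trans 0<x x≤x′ , 2x′≤x″
    where
    open ZP.≤-Reasoning
    x′ = x (suc n)
    x≤x′ : x n ≤ x′
    x≤x′ = doubled⇒≤ 0<x 2x≤x′
    0≤x′-x : 0ℤ ≤ x′ - x n
    0≤x′-x = ZP.i≤j⇒0≤j-i x≤x′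
    0≤2[x′-2x] : 0ℤ ≤ + 2 * (x′ - + 2 * x n)
    0≤2[x′-2x] = *-nonNeg {+ 2} (+≤+ z≤n) (ZP.i≤j⇒0≤j-i 2x≤x′)
    2x′≤x″ : + 2 * x′ ≤ x (suc (suc n))
    2x′≤x″ = begin
      + 2 * x′                          ≤⟨ ZP.i≤i+j _ _ {{nonNegative 0≤2[x′-2x]}} ⟩
      + 2 * x′ + + 2 * (x′ - + 2 * x n) ≡⟨ double-difference (x n) x′ ⟩
      + 4 * (x′ - x n)                  ≤⟨ ZP.*-monoʳ-≤-nonNeg _ {{nonNegative 0≤x′-x}} (+≤+ 4≤b) ⟩
      + b * (x′ - x n)                  ≤⟨ recurrence n ⟩
      x (suc (suc n))                   ∎

  terms-positive : ∀ n → 0ℤ < x n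
  terms-positive n = proj₁ (doubling n)

  initial≤ : ∀ n → x 0 ≤ x n
  initial≤ zero = ZP.≤-refl
  initial≤ (suc n) = ZP.≤-trans (initial≤ n) (doubled⇒≤ (terms-positive n) (proj₂ (doubling n)))

charPoly : ℕ → ℤ → ℤ
charPoly b k = k * k - + b * k + + b

charPoly-negative : ∀ {b k} → 4 N.< b → + 2 ≤ k → k ≤ + b - + 2 → 0ℤ < - charPoly b k
charPoly-negative {b} {k} 4<b 2≤k k≤b-2 =
  subst (0ℤ <_) (sym (factorisation k (+ b)))
    (0<1+i (ZP.+-mono-≤ (*-nonNeg (ZP.i≤j⇒0≤j-i 2≤k) (ZP.i≤j⇒0≤j-i k≤b-2)) (ZP.i≤j⇒0≤j-i (+≤+ 4<b))))
  where
  factorisation : ∀ k B → - (k * k - B * k + B) ≡ 1ℤ + ((k - + 2) * ((B - + 2) - k) + (B - + 5))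
  factorisation = solve-∀

charPoly-positive : ∀ {b k} → + 1 ≤ k → + b - + 1 ≤ k → 0ℤ < charPoly b k
charPoly-positive {b} {k} 1≤k b-1≤k =
  subst (0ℤ <_) (sym (factorisation k (+ b)))
    (0<1+i (*-nonNeg (ZP.i≤j⇒0≤j-i 1≤k) (ZP.i≤j⇒0≤j-i b-1≤k)))
  where
  factorisation : ∀ k B → k * k - B * k + B ≡ 1ℤ + (k - 1ℤ) * (k - (B - 1ℤ))
  factorisation = solve-∀

weight : ℕ → ℕ → ℤ
weight b zero = 1ℤ
weight b (suc zero) = + 2 * + b
weight b (suc (suc n)) = + b * (weight b (suc n) - weight b n) + (+ b) ^ suc (suc n)

weight-positive : ∀ {b} → 4 N.≤ b → ∀ n → 0ℤ < weight b n
weight-positive {b} 4≤b = Doubling.terms-positive 4≤b (weight b) recurrence (+<+ (s≤s z≤n))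
  (ZP.*-monoˡ-≤-nonNeg (+ 2) (+≤+ (NP.≤-trans (s≤s z≤n) 4≤b)))
  where
  recurrence : ∀ n → + b * (weight b (suc n) - weight b n) ≤ weight b (suc (suc n))
  recurrence n = ZP.i≤i+j _ _ {{nonNegative (^-nonNeg (suc (suc n)) (+≤+ z≤n))}}

offset-shift : ∀ c B u v w → w ≡ c + B * (v - u) → w - c ≡ B * ((v - c) - (u - c))
offset-shift c B u v _ refl = identity c B u v
  where
  identity : ∀ c B u v → (c + B * (v - u)) - c ≡ B * ((v - c) - (u - c))
  identity = solve-∀

casoratian-shift : ∀ B x y z w → z ≡ B * (y - x) → w ≡ B * (z - y) →
  z * z - y * w ≡ B * (y * y - x * z)
casoratian-shift B x y _ _ refl refl = identity B x y
  where
  identity : ∀ B x y → let z = B * (y - x) in z * z - y * (B * (z - y)) ≡ B * (y * y - x * z)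
  identity = solve-∀

cross-shift : ∀ c B u v w x y → w ≡ c + B * (v - u) → x ≡ c + B * (w - v) → y ≡ c + B * (x - w) →
  y * (w + 1ℤ) - x * (x + 1ℤ)
    ≡ B * ((x * (v + 1ℤ) - w * (w + 1ℤ)) - (w * (u + 1ℤ) - v * (v + 1ℤ)))
      - B * ((v - c) * (v - c) - (u - c) * (w - c))
cross-shift c B u v _ _ _ refl refl refl = identity c B u v
  where
  identity : ∀ c B u v → let w = c + B * (v - u) ; x = c + B * (w - v) ; y = c + B * (x - w) in
    y * (w + 1ℤ) - x * (x + 1ℤ)
      ≡ B * ((x * (v + 1ℤ) - w * (w + 1ℤ)) - (w * (u + 1ℤ) - v * (v + 1ℤ)))
        - B * ((v - c) * (v - c) - (u - c) * (w - c))
  identity = solve-∀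

module _ (b : ℕ) (k : ℤ) where
  private
    B c : ℤ
    B = + b
    c = k - B

  D-rec : ∀ n → D b (suc (suc n)) k ≡ c + B * (D b (suc n) k - D b n k)
  D-rec zero = identity k B
    where
    identity : ∀ k B → k + B * ((k * B - B) - 1ℤ) ≡ (k - B) + B * ((k + B * (k - 1ℤ)) - k)
    identity = solve-∀
  D-rec (suc n) = identity k B (d b n k) (d b (suc n) k)
    where
    identity : ∀ k B x y → k + B * (B * (y - x) - 1ℤ) ≡ (k - B) + B * ((k + B * (y - 1ℤ)) - (k + B * (x - 1ℤ)))
    identity = solve-∀

  E : ℕ → ℤ
  E h = D b h k - c

  E-rec : ∀ n → E (suc (suc n)) ≡ B * (E (suc n) - E n)
  E-rec n = offset-shift c B (D b n k) (D b (suc n) k) _ (D-rec n)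

  casoratian : ∀ n → E (suc n) * E (suc n) - E n * E (suc (suc n)) ≡ charPoly b k * B ^ suc (suc n)
  casoratian zero = identity k B
    where
    identity : ∀ k B → let E₀ = k - (k - B)
                           E₁ = (k + B * (k - 1ℤ)) - (k - B)
                           E₂ = (k + B * ((k * B - B) - 1ℤ)) - (k - B) in
      E₁ * E₁ - E₀ * E₂ ≡ (k * k - B * k + B) * (B * (B * 1ℤ))
    identity = solve-∀
  casoratian (suc n) = begin
    E (2 N.+ n) * E (2 N.+ n) - E (1 N.+ n) * E (3 N.+ n) ≡⟨ casoratian-shift B (E n) _ _ _ (E-rec n) (E-rec (suc n)) ⟩
    B * (E (1 N.+ n) * E (1 N.+ n) - E n * E (2 N.+ n))   ≡⟨ cong (B *_) (casoratian n) ⟩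
    B * (charPoly b k * B ^ suc (suc n))                  ≡⟨ x∙yz≈y∙xz B (charPoly b k) _ ⟩
    charPoly b k * B ^ suc (suc (suc n))                  ∎
    where open ≡-Reasoning

  k≤D : 4 N.≤ b → + 2 ≤ k → ∀ h → k ≤ D b h k
  k≤D 4≤b 2≤k h =
    subst₂ _≤_ (//-rightDividesˡ c k) (//-rightDividesˡ c (D b h k))
      (ZP.+-monoˡ-≤ c (Doubling.initial≤ 4≤b E (λ n → ZP.≤-reflexive (sym (E-rec n))) 0<E₀ 2E₀≤E₁ h))
    where
    0<E₀ : 0ℤ < E 0
    0<E₀ = subst (0ℤ <_) (sym (E₀≡ k B)) (+<+ (NP.≤-trans (s≤s z≤n) 4≤b))
      where
      E₀≡ : ∀ k B → k - (k - B) ≡ B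
      E₀≡ = solve-∀
    2E₀≤E₁ : + 2 * E 0 ≤ E 1
    2E₀≤E₁ = subst₂ _≤_ (sym (2E₀≡ k B)) (sym (E₁≡ k B)) (ZP.*-monoˡ-≤-nonNeg B 2≤k)
      where
      2E₀≡ : ∀ k B → + 2 * (k - (k - B)) ≡ B * + 2
      2E₀≡ = solve-∀
      E₁≡ : ∀ k B → (k + B * (k - 1ℤ)) - (k - B) ≡ B * k
      E₁≡ = solve-∀

  denom : ℕ → ℤ
  denom zero = 1ℤ
  denom (suc h) = D b h k + 1ℤ

  denom-positive : 4 N.≤ b → + 2 ≤ k → ∀ h → 0ℤ < denom h
  denom-positive _ _ zero = +<+ (s≤s z≤n)
  denom-positive 4≤b 2≤k (suc h) =
    subst (0ℤ <_) (ZP.+-comm 1ℤ (D b h k)) (0<1+i (ZP.≤-trans (ZP.≤-trans (+≤+ z≤n) 2≤k) (k≤D 4≤b 2≤k h)))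

  Dbar≡D÷denom : ∀ h → Dbar b h k ≡ D b h k ÷ℤ denom h
  Dbar≡D÷denom zero = refl
  Dbar≡D÷denom (suc h) = refl

  cross : ℕ → ℤ
  cross h = D b (suc h) k * denom h - D b h k * denom (suc h)

  cross-rec : ∀ n → cross (suc (suc n)) ≡ B * (cross (suc n) - cross n) - charPoly b k * B ^ suc (suc n)
  cross-rec zero = identity k B
    where
    identity : ∀ k B → let D₁ = k + B * (k - 1ℤ)
                           D₂ = k + B * ((k * B - B) - 1ℤ)
                           D₃ = k + B * (B * ((k * B - B) - k) - 1ℤ) in
      D₃ * (D₁ + 1ℤ) - D₂ * (D₂ + 1ℤ)
        ≡ B * ((D₂ * (k + 1ℤ) - D₁ * (D₁ + 1ℤ)) - (D₁ * 1ℤ - k * (k + 1ℤ)))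
          - (k * k - B * k + B) * (B * (B * 1ℤ))
    identity = solve-∀
  cross-rec (suc n) = begin
    cross (3 N.+ n)
      ≡⟨ cross-shift c B (D b n k) _ _ _ _ (D-rec n) (D-rec (suc n)) (D-rec (suc (suc n))) ⟩
    B * (cross (2 N.+ n) - cross (1 N.+ n)) - B * (E (1 N.+ n) * E (1 N.+ n) - E n * E (2 N.+ n))
      ≡⟨ cong (λ z → B * (cross (2 N.+ n) - cross (1 N.+ n)) - B * z) (casoratian n) ⟩
    B * (cross (2 N.+ n) - cross (1 N.+ n)) - B * (charPoly b k * B ^ suc (suc n))
      ≡⟨ cong (λ z → B * (cross (2 N.+ n) - cross (1 N.+ n)) - z) (x∙yz≈y∙xz B (charPoly b k) _) ⟩
    B * (cross (2 N.+ n) - cross (1 N.+ n)) - charPoly b k * B ^ suc (suc (suc n)) ∎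
    where open ≡-Reasoning

  cross≡ : ∀ n → cross n ≡ - charPoly b k * weight b n
  cross≡ = recurrence-unique (λ n u v → B * (u - v) - charPoly b k * B ^ suc (suc n))
    cross (λ n → - charPoly b k * weight b n) cross-rec
    (λ n → scaled-rec (charPoly b k) B (weight b (suc n)) (weight b n) (B ^ suc (suc n)))
    (cross₀ k B) (cross₁ k B)
    where
    scaled-rec : ∀ χ B w₁ w₀ p → - χ * (B * (w₁ - w₀) + p) ≡ B * (- χ * w₁ - - χ * w₀) - χ * p
    scaled-rec = solve-∀
    cross₀ : ∀ k B → (k + B * (k - 1ℤ)) * 1ℤ - k * (k + 1ℤ) ≡ - (k * k - B * k + B) * 1ℤ
    cross₀ = solve-∀
    cross₁ : ∀ k B → let D₁ = k + B * (k - 1ℤ) ; D₂ = k + B * ((k * B - B) - 1ℤ) in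
      D₂ * (k + 1ℤ) - D₁ * (D₁ + 1ℤ) ≡ - (k * k - B * k + B) * (+ 2 * B)
    cross₁ = solve-∀

  Dbar-ascending-step : 4 N.≤ b → + 2 ≤ k → 0ℤ < - charPoly b k → ∀ h → Dbar b h k Q.< Dbar b (suc h) k
  Dbar-ascending-step 4≤b 2≤k 0<-χ h =
    subst (Q._< Dbar b (suc h) k) (sym (Dbar≡D÷denom h))
      (÷ℤ-< (denom-positive 4≤b 2≤k h) (denom-positive 4≤b 2≤k (suc h))
        (subst (0ℤ <_) (sym (cross≡ h)) (*-pos 0<-χ (weight-positive 4≤b h))))

  Dbar-descending-step : 4 N.≤ b → + 2 ≤ k → 0ℤ < charPoly b k → ∀ h → Dbar b (suc h) k Q.< Dbar b h k
  Dbar-descending-step 4≤b 2≤k 0<χ h =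
    subst (Dbar b (suc h) k Q.<_) (sym (Dbar≡D÷denom h))
      (÷ℤ-< (denom-positive 4≤b 2≤k (suc h)) (denom-positive 4≤b 2≤k h)
        (subst (0ℤ <_) negated-cross≡ (*-pos 0<χ (weight-positive 4≤b h))))
    where
    open ≡-Reasoning
    χ = charPoly b k
    negated-cross≡ : χ * weight b h ≡ D b h k * denom (suc h) - D b (suc h) k * denom h
    negated-cross≡ = begin
      χ * weight b h       ≡⟨ ZP.neg-involutive _ ⟨
      - - (χ * weight b h) ≡⟨ cong -_ (ZP.neg-distribˡ-* χ (weight b h)) ⟩
      - (- χ * weight b h) ≡⟨ cong -_ (cross≡ h) ⟨
      - cross h            ≡⟨ ⁻¹-anti-homo‿- (D b (suc h) k * denom h) _ ⟩
      D b h k * denom (suc h) - D b (suc h) k * denom h ∎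

lemma12 : (b : ℕ) → 4 N.< b →
    ((k : ℤ) → + 2 Z.≤ k → k Z.≤ + (b ∸ 2) →
       (h h′ : ℕ) → h N.< h′ → Dbar b h k Q.< Dbar b h′ k)
    × ((k : ℤ) → + (b ∸ 1) Z.≤ k →
       (h h′ : ℕ) → h N.< h′ → Dbar b h′ k Q.< Dbar b h k)
lemma12 b 4<b = ascending , descending
  where
  4≤b : 4 N.≤ b
  4≤b = NP.<⇒≤ 4<b
  ascending : (k : ℤ) → + 2 ≤ k → k ≤ + (b ∸ 2) → (h h′ : ℕ) → h N.< h′ → Dbar b h k Q.< Dbar b h′ k
  ascending k 2≤k k≤b∸2 _ _ = step⇒ascending {_≺_ = Q._<_} QP.<-trans (λ h → Dbar b h k)
    (Dbar-ascending-step b k 4≤b 2≤k (charPoly-negative 4<b 2≤k k≤b-2))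
    where
    -- + b - + 2 computes to b ⊖ 2, which ⊖-≥ identifies with the truncated b ∸ 2.
    k≤b-2 : k ≤ + b - + 2
    k≤b-2 = subst (k ≤_) (sym (ZP.⊖-≥ (NP.≤-trans (s≤s (s≤s z≤n)) 4≤b))) k≤b∸2
  descending : (k : ℤ) → + (b ∸ 1) ≤ k → (h h′ : ℕ) → h N.< h′ → Dbar b h′ k Q.< Dbar b h k
  descending k b∸1≤k _ _ = step⇒ascending {_≺_ = flip Q._<_} (flip QP.<-trans) (λ h → Dbar b h k)
    (Dbar-descending-step b k 4≤b 2≤k (charPoly-positive (ZP.≤-trans (+≤+ (s≤s z≤n)) 2≤k) b-1≤k))
    where
    b-1≤k : + b - + 1 ≤ k
    b-1≤k = subst (_≤ k) (sym (ZP.⊖-≥ (NP.≤-trans (s≤s z≤n) 4≤b))) b∸1≤k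
    2≤k : + 2 ≤ k
    2≤k = ZP.≤-trans (+≤+ (NP.≤-trans (s≤s (s≤s z≤n)) (NP.∸-monoˡ-≤ 1 4<b))) b∸1≤k
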